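{- For every purely modal formula $A$ (no $\blacksquare$, no $\lozenge^{\bullet}$), $A$ is derivable in $\mathbf{DKS5}$ iff $A$ is a theorem of S5.
   Context: Formulae are in negation normal form over $a,\neg a,\lor,\land,\square,\blacksquare,\lozenge,\lozenge^{\bullet}$, where $\lozenge^{\bullet}$ is the past diamond (dual of $\blacksquare$). Nested sequents are multisets of formulae and structures $\circ\{\Gamma\}$, $\bullet\{\Delta\}$; $\Sigma[\,]$ is a context with a hole at any depth. $\mathbf{DKS5}$ is the restriction of the deep system $\mathbf{DS5}$ to its purely modal rules (those mentioning no $\blacksquare$, $\lozenge^{\bullet}$ or $\bullet$), namely: $id$: $\Sigma[a,\overline a]$; $\land$: from $\Sigma[A\land B,A]$ and $\Sigma[A\land B,B]$ infer $\Sigma[A\land B]$; $\lor$: from $\Sigma[A\lor B,A,B]$ infer $\Sigma[A\lor B]$; $\square$: from $\Sigma[\square A,\circ\{A\}]$ infer $\Sigma[\square A]$; $\lozenge_1$: from $\Sigma[\circ\{\Delta,A\},\lozenge A]$ infer $\Sigma[\circ\{\Delta\},\lozenge A]$; $T_b$: from $\Sigma[\lozenge A,A]$ infer $\Sigma[\lozenge A]$; $4_c$: from $\Sigma[\lozenge A,\circ\{\lozenge A,\Delta\}]$ infer $\Sigma[\lozenge A,\circ\{\Delta\}]$; $5_b$: from $\Sigma[\circ\{\Delta,\lozenge A\},\lozenge A]$ infer $\Sigma[\circ\{\Delta,\lozenge A\}]$. -}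

module Defs where

open import Data.Nat using (ℕ)
open import Data.List using (List; []; _∷_; _++_)
open import Data.List.Relation.Binary.Permutation.Propositional using (_↭_)

data Fm : Set where
  pos  : ℕ → Fm
  neg  : ℕ → Fm
  _∨_  : Fm → Fm → Fm
  _∧_  : Fm → Fm → Fm
  □    : Fm → Fm            -- future box
  ■    : Fm → Fm            -- past box
  ◇    : Fm → Fm            -- future diamond
  ◆    : Fm → Fm            -- past diamond (dual of ■)

infixr 5 _∨_
infixr 6 _∧_

data Modal : Fm → Set where
  pos : ∀ n → Modal (pos n)
  neg : ∀ n → Modal (neg n)
  _∨_ : ∀ {A B} → Modal A → Modal B → Modal (A ∨ B)
  _∧_ : ∀ {A B} → Modal A → Modal B → Modal (A ∧ B)
  □   : ∀ {A} → Modal A → Modal (□ A)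
  ◇   : ∀ {A} → Modal A → Modal (◇ A)

-- Nested sequents: lists of items, read as multisets
-- (permutation is a structural rule applicable at any depth, see below)

data Item : Set where
  fm  : Fm → Item
  ∘⟨_⟩ : List Item → Item
  •⟨_⟩ : List Item → Item

Seq : Set
Seq = List Item

data Ctx : Set where
  hole : Seq → Ctx
  ∘ctx : Seq → Ctx → Ctx
  •ctx : Seq → Ctx → Ctx

_[_] : Ctx → Seq → Seq
hole Γ     [ Δ ] = Γ ++ Δ
∘ctx Γ C   [ Δ ] = Γ ++ (∘⟨ C [ Δ ] ⟩ ∷ [])
•ctx Γ C   [ Δ ] = Γ ++ (•⟨ C [ Δ ] ⟩ ∷ [])

-- DKS5: the purely modal rules of DS5

data DKS5 : Seq → Set where
  perm : ∀ C {Γ Γ'} → Γ ↭ Γ' → DKS5 (C [ Γ ]) → DKS5 (C [ Γ' ])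
  id   : ∀ C n → DKS5 (C [ fm (pos n) ∷ fm (neg n) ∷ [] ])
  ∧r   : ∀ C A B → DKS5 (C [ fm (A ∧ B) ∷ fm A ∷ [] ])
                 → DKS5 (C [ fm (A ∧ B) ∷ fm B ∷ [] ])
                 → DKS5 (C [ fm (A ∧ B) ∷ [] ])
  ∨r   : ∀ C A B → DKS5 (C [ fm (A ∨ B) ∷ fm A ∷ fm B ∷ [] ])
                 → DKS5 (C [ fm (A ∨ B) ∷ [] ])
  □r   : ∀ C A → DKS5 (C [ fm (□ A) ∷ ∘⟨ fm A ∷ [] ⟩ ∷ [] ])
               → DKS5 (C [ fm (□ A) ∷ [] ])
  ◇₁   : ∀ C Δ A → DKS5 (C [ ∘⟨ Δ ++ (fm A ∷ []) ⟩ ∷ fm (◇ A) ∷ [] ])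
                 → DKS5 (C [ ∘⟨ Δ ⟩ ∷ fm (◇ A) ∷ [] ])
  Tb   : ∀ C A → DKS5 (C [ fm (◇ A) ∷ fm A ∷ [] ])
               → DKS5 (C [ fm (◇ A) ∷ [] ])
  4c   : ∀ C Δ A → DKS5 (C [ fm (◇ A) ∷ ∘⟨ fm (◇ A) ∷ Δ ⟩ ∷ [] ])
                 → DKS5 (C [ fm (◇ A) ∷ ∘⟨ Δ ⟩ ∷ [] ])
  5b   : ∀ C Δ A → DKS5 (C [ ∘⟨ Δ ++ (fm (◇ A) ∷ []) ⟩ ∷ fm (◇ A) ∷ [] ])
                 → DKS5 (C [ ∘⟨ Δ ++ (fm (◇ A) ∷ []) ⟩ ∷ [] ])

data HFm : Set where
  var  : ℕ → HFm
  ⊥'   : HFm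
  _⇒_  : HFm → HFm → HFm
  □'   : HFm → HFm

infixr 4 _⇒_

¬' : HFm → HFm
¬' A = A ⇒ ⊥'

_∨'_ : HFm → HFm → HFm
A ∨' B = ¬' A ⇒ B

_∧'_ : HFm → HFm → HFm
A ∧' B = ¬' (A ⇒ ¬' B)

◇' : HFm → HFm
◇' A = ¬' (□' (¬' A))

data S5 : HFm → Set where
  ax1 : ∀ A B → S5 (A ⇒ B ⇒ A)
  ax2 : ∀ A B C → S5 ((A ⇒ B ⇒ C) ⇒ (A ⇒ B) ⇒ A ⇒ C)
  ax3 : ∀ A → S5 (¬' (¬' A) ⇒ A)
  axK : ∀ A B → S5 (□' (A ⇒ B) ⇒ □' A ⇒ □' B)
  axT : ∀ A → S5 (□' A ⇒ A)
  ax5 : ∀ A → S5 (◇' A ⇒ □' (◇' A))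
  mp  : ∀ {A B} → S5 (A ⇒ B) → S5 A → S5 B
  nec : ∀ {A} → S5 A → S5 (□' A)

tr : (A : Fm) → Modal A → HFm
tr .(pos n) (pos n) = var n
tr .(neg n) (neg n) = ¬' (var n)
tr (A ∨ B) (p ∨ q) = tr A p ∨' tr B q
tr (A ∧ B) (p ∧ q) = tr A p ∧' tr B q
tr (□ A) (□ p) = □' (tr A p)
tr (◇ A) (◇ p) = ◇' (tr A p)

-- Soundness: read a nested sequent as the disjunction of its members and a structure
-- ∘{Γ} as □ of the reading of Γ.  Each rule then becomes an S5 implication from its
-- premises to its conclusion, which survives being put into any context since □ is
-- monotone.  The propositional reasoning is done by checking truth tables, which
-- Kalmár's lemma turns into S5 proofs.
--
-- Completeness: search for a proof of A backwards, on trees of labelled nodes whose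
-- labels stay among the subformulas of A.  Every rule application adds a subformula
-- to a label or, for □, adds a node for a subformula that occurs nowhere yet, so the
-- search terminates.  If it does not close, the labels of the final saturated tree
-- are the worlds of a universal (hence S5) model in which every formula of every
-- label is false; in particular A is not an S5 theorem.

module Submission where

open import Defs
open import Data.Bool using (Bool; true; false; not; T) renaming (_∧_ to _∧ᵇ_; _∨_ to _∨ᵇ_)
open import Data.Bool.ListAction using (and; or; all; any)
open import Data.Bool.Properties using (T-∧; T-∨)
open import Data.Empty using (⊥-elim)
open import Data.List using (List; []; _∷_; _++_; length; map)
open import Data.List.Properties using (++-assoc; ++-identityʳ; map-cong)
open import Data.List.Membership.Propositional using (_∈_; find)
open import Data.List.Membership.Propositional.Properties using (∈-∃++; ∈-++⁻; ∈-++⁺ˡ; ∈-++⁺ʳ; ∈-map⁺)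
open import Data.List.Relation.Binary.Permutation.Propositional as ↭
  using (_↭_; refl; prep; swap; ↭-refl; ↭-sym; module PermutationReasoning)
open import Data.List.Relation.Binary.Permutation.Propositional.Properties using (∈-resp-↭; ++⁺ˡ; ++⁺ʳ; ++-comm; shift)
open import Data.List.Relation.Unary.All using (All; []; _∷_; lookup; tabulate; zipWith)
open import Data.List.Relation.Unary.All.Properties using (all⁺; all⁻)
open import Data.List.Relation.Unary.Any using (Any; here; there; any?)
import Data.List.Relation.Unary.Any.Properties as Anyₚ
open import Data.Nat using (ℕ; zero; suc; _+_; _≤_; _<_; _⊔_; z≤n; s≤s; _≟_)
open import Data.Nat.Induction using (<-wellFounded)
open import Data.Nat.Properties
  using ( ≤-trans; ≤-reflexive; m≤m⊔n; m≤n⊔m; +-suc; +-identityʳ; +-assoc; ≤∧≢⇒<; m≤n⇒m≤1+n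
        ; m≤n⇒m<n∨m≡n; +-monoʳ-<; +-monoˡ-<)
open import Data.Product using (∃; _×_; _,_; proj₁; proj₂)
open import Data.Product.Relation.Binary.Lex.Strict using (×-Lex; ×-wellFounded)
open import Data.Sum using (_⊎_; inj₁; inj₂; [_,_])
open import Data.Unit using (⊤; tt)
open import Function using (_∘_; _⇔_; mk⇔; Equivalence)
open import Induction.WellFounded using (Acc; acc; WellFounded)
open import Relation.Binary.Definitions using (DecidableEquality)
open import Relation.Binary.PropositionalEquality
  using (_≡_; refl; sym; trans; cong; cong₂; subst; subst₂; module ≡-Reasoning)
open import Relation.Nullary using (Dec; yes; no; ¬_; does; map′)
open import Relation.Nullary.Decidable using (_×-dec_)
open import Relation.Unary using (_⊆_)

-- Hilbert derivations and truth-table tautologies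

infix 2 _⊢_
infixl 5 _·_

data _⊢_ (Γ : List HFm) : HFm → Set where
  hyp : ∀ {A} → A ∈ Γ → Γ ⊢ A
  thm : ∀ {A} → S5 A → Γ ⊢ A
  _·_ : ∀ {A B} → Γ ⊢ A ⇒ B → Γ ⊢ A → Γ ⊢ B

⇒-refl : ∀ A → S5 (A ⇒ A)
⇒-refl A = mp (mp (ax2 A (A ⇒ A) A) (ax1 A (A ⇒ A))) (ax1 A A)

deduction : ∀ {Γ A B} → A ∷ Γ ⊢ B → Γ ⊢ A ⇒ B
deduction {A = A} (hyp (here refl)) = thm (⇒-refl A)
deduction {A = A} (hyp (there p))   = thm (ax1 _ A) · hyp p
deduction {A = A} (thm d)           = thm (ax1 _ A) · thm d
deduction {A = A} (d · e)           = thm (ax2 A _ _) · deduction d · deduction e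

⊢-weaken : ∀ {Γ A B} → Γ ⊢ A → B ∷ Γ ⊢ A
⊢-weaken (hyp p) = hyp (there p)
⊢-weaken (thm d) = thm d
⊢-weaken (d · e) = ⊢-weaken d · ⊢-weaken e

⊢-closed : ∀ {A} → [] ⊢ A → S5 A
⊢-closed (thm d) = d
⊢-closed (d · e) = mp (⊢-closed d) (⊢-closed e)

ex-falso : ∀ A → S5 (⊥' ⇒ A)
ex-falso A = ⊢-closed (deduction (thm (ax3 A) · (thm (ax1 ⊥' (¬' A)) · hyp (here refl))))

by-cases : ∀ {Γ P A} → P ∷ Γ ⊢ A → ¬' P ∷ Γ ⊢ A → Γ ⊢ A
by-cases {Γ} {P} {A} d e = thm (ax3 A) · deduction (hyp (here refl) · (⊢-weaken (deduction e) · ¬P))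
  where
  ¬P : ¬' A ∷ Γ ⊢ ¬' P
  ¬P = deduction (hyp (there (here refl)) · (⊢-weaken (⊢-weaken (deduction d)) · hyp (here refl)))

infixr 4 _⊃_

data Schema : Set where
  v   : ℕ → Schema
  bot : Schema
  _⊃_ : Schema → Schema → Schema

infixr 5 _∨ₛ_
infixr 6 _∧ₛ_

¬ₛ : Schema → Schema
¬ₛ φ = φ ⊃ bot

_∨ₛ_ : Schema → Schema → Schema
φ ∨ₛ ψ = ¬ₛ φ ⊃ ψ

_∧ₛ_ : Schema → Schema → Schema
φ ∧ₛ ψ = ¬ₛ (φ ⊃ ¬ₛ ψ)

nth : List HFm → ℕ → HFm
nth []      i       = ⊥'
nth (A ∷ σ) zero    = A
nth (A ∷ σ) (suc i) = nth σ i

instantiate : List HFm → Schema → HFm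
instantiate σ (v i)   = nth σ i
instantiate σ bot     = ⊥'
instantiate σ (φ ⊃ ψ) = instantiate σ φ ⇒ instantiate σ ψ

eval : (ℕ → Bool) → Schema → Bool
eval ρ (v i)   = ρ i
eval ρ bot     = false
eval ρ (φ ⊃ ψ) = not (eval ρ φ) ∨ᵇ eval ρ ψ

varBound : Schema → ℕ
varBound (v i)   = suc i
varBound bot     = 0
varBound (φ ⊃ ψ) = varBound φ ⊔ varBound ψ

-- A list  b ∷ bs  assigns b to the variable  length bs,  so valuations grow at the head.
valuation : List Bool → ℕ → Bool
valuation []       i = false
valuation (b ∷ bs) i with i ≟ length bs
... | yes _ = b
... | no  _ = valuation bs i

truthTable : ℕ → List Bool → Schema → Bool
truthTable zero    bs φ = eval (valuation bs) φ
truthTable (suc k) bs φ = truthTable k (true ∷ bs) φ ∧ᵇ truthTable k (false ∷ bs) φ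

isTautology : Schema → Bool
isTautology φ = truthTable (varBound φ) [] φ

signed : Bool → HFm → HFm
signed true  A = A
signed false A = ¬' A

module Kalmar (σ : List HFm) where

  literals : List Bool → List HFm
  literals []       = []
  literals (b ∷ bs) = signed b (nth σ (length bs)) ∷ literals bs

  literal∈ : ∀ bs {i} → i < length bs → signed (valuation bs i) (nth σ i) ∈ literals bs
  literal∈ (b ∷ bs) {i} (s≤s i≤) with i ≟ length bs
  ... | yes refl = here refl
  ... | no  i≢   = there (literal∈ bs (≤∧≢⇒< i≤ i≢))

  kalmar : ∀ bs φ → varBound φ ≤ length bs →
           literals bs ⊢ signed (eval (valuation bs) φ) (instantiate σ φ)
  kalmar bs (v i)   i< = hyp (literal∈ bs i<)
  kalmar bs bot     _  = thm (⇒-refl ⊥')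
  kalmar bs (φ ⊃ ψ) ≤bs
    with eval (valuation bs) φ | eval (valuation bs) ψ
       | kalmar bs φ (≤-trans (m≤m⊔n _ _) ≤bs) | kalmar bs ψ (≤-trans (m≤n⊔m _ _) ≤bs)
  ... | false | _     | ¬φ | _  = deduction (thm (ex-falso _) · (⊢-weaken ¬φ · hyp (here refl)))
  ... | true  | true  | _  | ψ′ = deduction (⊢-weaken ψ′)
  ... | true  | false | φ′ | ¬ψ = deduction (⊢-weaken ¬ψ · (hyp (here refl) · ⊢-weaken φ′))

  truthTable-sound : ∀ k bs φ → varBound φ ≤ k + length bs → T (truthTable k bs φ) →
                     literals bs ⊢ instantiate σ φ
  truthTable-sound zero bs φ ≤bs holds with eval (valuation bs) φ | kalmar bs φ ≤bs
  ... | true | d = d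
  truthTable-sound (suc k) bs φ ≤k+bs holds =
    by-cases (truthTable-sound k (true ∷ bs) φ ≤k+bs′ holds-true)
             (truthTable-sound k (false ∷ bs) φ ≤k+bs′ holds-false)
    where
    ≤k+bs′ = subst (varBound φ ≤_) (sym (+-suc k (length bs))) ≤k+bs
    holds-true  = Equivalence.to T-∧ holds .proj₁
    holds-false = Equivalence.to T-∧ holds .proj₂

tautology : (φ : Schema) → {T (isTautology φ)} → (σ : List HFm) → S5 (instantiate σ φ)
tautology φ {holds} σ =
  ⊢-closed (Kalmar.truthTable-sound σ (varBound φ) [] φ (≤-reflexive (sym (+-identityʳ _))) holds)

-- Soundness

mp₂ : ∀ {A B C} → S5 (A ⇒ B ⇒ C) → S5 A → S5 B → S5 C
mp₂ f a b = mp (mp f a) b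

mp₃ : ∀ {A B C D} → S5 (A ⇒ B ⇒ C ⇒ D) → S5 A → S5 B → S5 C → S5 D
mp₃ f a b c = mp (mp₂ f a b) c

⇒-trans : ∀ {A B C} → S5 (A ⇒ B) → S5 (B ⇒ C) → S5 (A ⇒ C)
⇒-trans {A} {B} {C} = mp₂ (tautology ((v 0 ⊃ v 1) ⊃ (v 1 ⊃ v 2) ⊃ v 0 ⊃ v 2) (A ∷ B ∷ C ∷ []))

□-mono : ∀ {A B} → S5 (A ⇒ B) → S5 (□' A ⇒ □' B)
□-mono {A} {B} f = mp (axK A B) (nec f)

□-mono₂ : ∀ {A B C} → S5 (A ⇒ B ⇒ C) → S5 (□' A ⇒ □' B ⇒ □' C)
□-mono₂ {A} {B} {C} f = ⇒-trans (□-mono f) (axK B C)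

◇-intro : ∀ A → S5 (A ⇒ ◇' A)
◇-intro A = mp (tautology ((v 1 ⊃ ¬ₛ (v 0)) ⊃ v 0 ⊃ ¬ₛ (v 1)) (A ∷ □' (¬' A) ∷ [])) (axT (¬' A))

◇□⇒□ : ∀ A → S5 (◇' (□' A) ⇒ □' A)
◇□⇒□ A = mp₃ (tautology ((¬ₛ (v 1) ⊃ v 3) ⊃ (v 3 ⊃ v 0) ⊃ (v 1 ⊃ v 2) ⊃ ¬ₛ (v 0) ⊃ v 2)
                        (□' (¬' (□' A)) ∷ □' (¬' (¬' A)) ∷ □' A ∷ □' (◇' (¬' A)) ∷ []))
             (ax5 (¬' A)) (□-mono (contraposition (□-mono double-negation))) (□-mono (ax3 A))
  where
  double-negation : S5 (A ⇒ ¬' (¬' A))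
  double-negation = tautology (v 0 ⊃ ¬ₛ (¬ₛ (v 0))) (A ∷ [])
  contraposition : S5 (□' A ⇒ □' (¬' (¬' A))) → S5 (¬' (□' (¬' (¬' A))) ⇒ ¬' (□' A))
  contraposition = mp (tautology ((v 0 ⊃ v 1) ⊃ ¬ₛ (v 1) ⊃ ¬ₛ (v 0)) (□' A ∷ □' (¬' (¬' A)) ∷ []))

axiom4 : ∀ A → S5 (□' A ⇒ □' (□' A))
axiom4 A = ⇒-trans (⇒-trans (◇-intro (□' A)) (ax5 (□' A))) (□-mono (◇□⇒□ A))

¬◇⇒□¬◇ : ∀ A → S5 (¬' (◇' A) ⇒ □' (¬' (◇' A)))
¬◇⇒□¬◇ A = ⇒-trans (ax3 (□' (¬' A)))
                   (⇒-trans (axiom4 (¬' A)) (□-mono (tautology (v 0 ⊃ ¬ₛ (¬ₛ (v 0))) (□' (¬' A) ∷ []))))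

-- ■, ◆ and • are read as □, ◇ and ∘: no DKS5 rule acts on them, so any reading will do.
⌜_⌝ : Fm → HFm
⌜ pos n ⌝ = var n
⌜ neg n ⌝ = ¬' (var n)
⌜ A ∨ B ⌝ = ⌜ A ⌝ ∨' ⌜ B ⌝
⌜ A ∧ B ⌝ = ⌜ A ⌝ ∧' ⌜ B ⌝
⌜ □ A ⌝   = □' ⌜ A ⌝
⌜ ■ A ⌝   = □' ⌜ A ⌝
⌜ ◇ A ⌝   = ◇' ⌜ A ⌝
⌜ ◆ A ⌝   = ◇' ⌜ A ⌝

mutual
  ⌜_⌝ˢ : Seq → HFm
  ⌜ [] ⌝ˢ    = ⊥'
  ⌜ x ∷ Γ ⌝ˢ = ⌜ x ⌝ⁱ ∨' ⌜ Γ ⌝ˢ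

  ⌜_⌝ⁱ : Item → HFm
  ⌜ fm A ⌝ⁱ   = ⌜ A ⌝
  ⌜ ∘⟨ Γ ⟩ ⌝ⁱ = □' ⌜ Γ ⌝ˢ
  ⌜ •⟨ Γ ⟩ ⌝ⁱ = □' ⌜ Γ ⌝ˢ

tr≡⌜⌝ : ∀ A (m : Modal A) → tr A m ≡ ⌜ A ⌝
tr≡⌜⌝ _       (pos n) = refl
tr≡⌜⌝ _       (neg n) = refl
tr≡⌜⌝ (A ∨ B) (p ∨ q) = cong₂ _∨'_ (tr≡⌜⌝ A p) (tr≡⌜⌝ B q)
tr≡⌜⌝ (A ∧ B) (p ∧ q) = cong₂ _∧'_ (tr≡⌜⌝ A p) (tr≡⌜⌝ B q)
tr≡⌜⌝ (□ A)   (□ p)   = cong □' (tr≡⌜⌝ A p)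
tr≡⌜⌝ (◇ A)   (◇ p)   = cong ◇' (tr≡⌜⌝ A p)

++-split : ∀ Γ Δ → S5 (⌜ Γ ++ Δ ⌝ˢ ⇒ ⌜ Γ ⌝ˢ ∨' ⌜ Δ ⌝ˢ)
++-split []      Δ = tautology (v 0 ⊃ bot ∨ₛ v 0) (⌜ Δ ⌝ˢ ∷ [])
++-split (x ∷ Γ) Δ =
  mp (tautology ((v 0 ⊃ v 1 ∨ₛ v 2) ⊃ v 3 ∨ₛ v 0 ⊃ (v 3 ∨ₛ v 1) ∨ₛ v 2)
                (⌜ Γ ++ Δ ⌝ˢ ∷ ⌜ Γ ⌝ˢ ∷ ⌜ Δ ⌝ˢ ∷ ⌜ x ⌝ⁱ ∷ []))
     (++-split Γ Δ)

++-join : ∀ Γ Δ → S5 (⌜ Γ ⌝ˢ ∨' ⌜ Δ ⌝ˢ ⇒ ⌜ Γ ++ Δ ⌝ˢ)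
++-join []      Δ = tautology (bot ∨ₛ v 0 ⊃ v 0) (⌜ Δ ⌝ˢ ∷ [])
++-join (x ∷ Γ) Δ =
  mp (tautology ((v 1 ∨ₛ v 2 ⊃ v 0) ⊃ (v 3 ∨ₛ v 1) ∨ₛ v 2 ⊃ v 3 ∨ₛ v 0)
                (⌜ Γ ++ Δ ⌝ˢ ∷ ⌜ Γ ⌝ˢ ∷ ⌜ Δ ⌝ˢ ∷ ⌜ x ⌝ⁱ ∷ []))
     (++-join Γ Δ)

□∨⊥-nec : ∀ {A} → S5 A → S5 (□' A ∨' ⊥')
□∨⊥-nec {A} d = mp (tautology (v 0 ⊃ v 0 ∨ₛ bot) (□' A ∷ [])) (nec d)

ctx-valid : ∀ C {Δ} → S5 ⌜ Δ ⌝ˢ → S5 ⌜ C [ Δ ] ⌝ˢ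
ctx-valid (hole Γ)   {Δ} d =
  mp₂ (tautology ((v 2 ∨ₛ v 1 ⊃ v 0) ⊃ v 1 ⊃ v 0) (⌜ Γ ++ Δ ⌝ˢ ∷ ⌜ Δ ⌝ˢ ∷ ⌜ Γ ⌝ˢ ∷ [])) (++-join Γ Δ) d
ctx-valid (∘ctx Γ C) d = ctx-valid (hole Γ) (□∨⊥-nec (ctx-valid C d))
ctx-valid (•ctx Γ C) d = ctx-valid (hole Γ) (□∨⊥-nec (ctx-valid C d))

□∨⊥-mono₂ : ∀ {A B C} → S5 (A ⇒ B ⇒ C) → S5 (□' A ∨' ⊥' ⇒ □' B ∨' ⊥' ⇒ □' C ∨' ⊥')
□∨⊥-mono₂ {A} {B} {C} f =
  mp (tautology ((v 0 ⊃ v 1 ⊃ v 2) ⊃ v 0 ∨ₛ bot ⊃ v 1 ∨ₛ bot ⊃ v 2 ∨ₛ bot) (□' A ∷ □' B ∷ □' C ∷ []))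
     (□-mono₂ f)

ctx-mono₂ : ∀ C {Δ₁ Δ₂ Δ} → S5 (⌜ Δ₁ ⌝ˢ ⇒ ⌜ Δ₂ ⌝ˢ ⇒ ⌜ Δ ⌝ˢ) →
            S5 (⌜ C [ Δ₁ ] ⌝ˢ ⇒ ⌜ C [ Δ₂ ] ⌝ˢ ⇒ ⌜ C [ Δ ] ⌝ˢ)
ctx-mono₂ (hole Γ) {Δ₁} {Δ₂} {Δ} f =
  mp (mp₃ (tautology ((v 0 ⊃ v 3 ∨ₛ v 4) ⊃ (v 1 ⊃ v 3 ∨ₛ v 5) ⊃ (v 3 ∨ₛ v 6 ⊃ v 2) ⊃
                      (v 4 ⊃ v 5 ⊃ v 6) ⊃ v 0 ⊃ v 1 ⊃ v 2)
                     (⌜ Γ ++ Δ₁ ⌝ˢ ∷ ⌜ Γ ++ Δ₂ ⌝ˢ ∷ ⌜ Γ ++ Δ ⌝ˢ ∷ ⌜ Γ ⌝ˢ ∷ ⌜ Δ₁ ⌝ˢ ∷ ⌜ Δ₂ ⌝ˢ ∷ ⌜ Δ ⌝ˢ ∷ []))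
          (++-split Γ Δ₁) (++-split Γ Δ₂) (++-join Γ Δ))
     f
ctx-mono₂ (∘ctx Γ C) f = ctx-mono₂ (hole Γ) (□∨⊥-mono₂ (ctx-mono₂ C f))
ctx-mono₂ (•ctx Γ C) f = ctx-mono₂ (hole Γ) (□∨⊥-mono₂ (ctx-mono₂ C f))

ctx-mono : ∀ C {Δ₁ Δ} → S5 (⌜ Δ₁ ⌝ˢ ⇒ ⌜ Δ ⌝ˢ) → S5 (⌜ C [ Δ₁ ] ⌝ˢ ⇒ ⌜ C [ Δ ] ⌝ˢ)
ctx-mono C {Δ₁} {Δ} f =
  mp (tautology ((v 0 ⊃ v 0 ⊃ v 1) ⊃ v 0 ⊃ v 1) (⌜ C [ Δ₁ ] ⌝ˢ ∷ ⌜ C [ Δ ] ⌝ˢ ∷ []))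
     (ctx-mono₂ C (mp (tautology ((v 0 ⊃ v 1) ⊃ v 0 ⊃ v 0 ⊃ v 1) (⌜ Δ₁ ⌝ˢ ∷ ⌜ Δ ⌝ˢ ∷ [])) f))

↭-sound : ∀ {Γ Δ} → Γ ↭ Δ → S5 (⌜ Γ ⌝ˢ ⇒ ⌜ Δ ⌝ˢ)
↭-sound {Γ} refl = ⇒-refl ⌜ Γ ⌝ˢ
↭-sound {x ∷ Γ} {_ ∷ Δ} (prep _ p) =
  mp (tautology ((v 1 ⊃ v 2) ⊃ v 0 ∨ₛ v 1 ⊃ v 0 ∨ₛ v 2) (⌜ x ⌝ⁱ ∷ ⌜ Γ ⌝ˢ ∷ ⌜ Δ ⌝ˢ ∷ [])) (↭-sound p)
↭-sound {x ∷ y ∷ Γ} {_ ∷ _ ∷ Δ} (swap _ _ p) =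
  mp (tautology ((v 2 ⊃ v 3) ⊃ v 0 ∨ₛ v 1 ∨ₛ v 2 ⊃ v 1 ∨ₛ v 0 ∨ₛ v 3) (⌜ x ⌝ⁱ ∷ ⌜ y ⌝ⁱ ∷ ⌜ Γ ⌝ˢ ∷ ⌜ Δ ⌝ˢ ∷ []))
     (↭-sound p)
↭-sound (↭.trans p q) = ⇒-trans (↭-sound p) (↭-sound q)

id-sound : ∀ n → S5 ⌜ fm (pos n) ∷ fm (neg n) ∷ [] ⌝ˢ
id-sound n = tautology (v 0 ∨ₛ ¬ₛ (v 0) ∨ₛ bot) (var n ∷ [])

∧r-sound : ∀ A B → S5 (⌜ fm (A ∧ B) ∷ fm A ∷ [] ⌝ˢ ⇒ ⌜ fm (A ∧ B) ∷ fm B ∷ [] ⌝ˢ ⇒ ⌜ fm (A ∧ B) ∷ [] ⌝ˢ)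
∧r-sound A B = tautology ((v 0 ∧ₛ v 1) ∨ₛ v 0 ∨ₛ bot ⊃ (v 0 ∧ₛ v 1) ∨ₛ v 1 ∨ₛ bot ⊃ (v 0 ∧ₛ v 1) ∨ₛ bot)
                         (⌜ A ⌝ ∷ ⌜ B ⌝ ∷ [])

∨r-sound : ∀ A B → S5 (⌜ fm (A ∨ B) ∷ fm A ∷ fm B ∷ [] ⌝ˢ ⇒ ⌜ fm (A ∨ B) ∷ [] ⌝ˢ)
∨r-sound A B = tautology ((v 0 ∨ₛ v 1) ∨ₛ v 0 ∨ₛ v 1 ∨ₛ bot ⊃ (v 0 ∨ₛ v 1) ∨ₛ bot) (⌜ A ⌝ ∷ ⌜ B ⌝ ∷ [])

□r-sound : ∀ A → S5 (⌜ fm (□ A) ∷ ∘⟨ fm A ∷ [] ⟩ ∷ [] ⌝ˢ ⇒ ⌜ fm (□ A) ∷ [] ⌝ˢ)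
□r-sound A =
  mp (tautology ((v 1 ⊃ v 0) ⊃ v 0 ∨ₛ v 1 ∨ₛ bot ⊃ v 0 ∨ₛ bot) (□' ⌜ A ⌝ ∷ □' (⌜ A ⌝ ∨' ⊥') ∷ []))
     (□-mono (tautology (v 0 ∨ₛ bot ⊃ v 0) (⌜ A ⌝ ∷ [])))

-- ¬◇A is □¬A, and □(Δ ∨ A) ∧ □¬A ⇒ □Δ by K.
◇₁-sound : ∀ Δ A → S5 (⌜ ∘⟨ Δ ++ (fm A ∷ []) ⟩ ∷ fm (◇ A) ∷ [] ⌝ˢ ⇒ ⌜ ∘⟨ Δ ⟩ ∷ fm (◇ A) ∷ [] ⌝ˢ)
◇₁-sound Δ A =
  mp₂ (tautology ((v 0 ⊃ v 1) ⊃ (v 1 ⊃ v 2 ⊃ v 3) ⊃ v 0 ∨ₛ ¬ₛ (v 2) ∨ₛ bot ⊃ v 3 ∨ₛ ¬ₛ (v 2) ∨ₛ bot)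
                 (□' ⌜ Δ ++ (fm A ∷ []) ⌝ˢ ∷ □' (¬' ⌜ A ⌝ ⇒ ⌜ Δ ⌝ˢ) ∷ □' (¬' ⌜ A ⌝) ∷ □' ⌜ Δ ⌝ˢ ∷ []))
      (□-mono (⇒-trans (++-split Δ (fm A ∷ []))
                       (tautology (v 0 ∨ₛ v 1 ∨ₛ bot ⊃ ¬ₛ (v 1) ⊃ v 0) (⌜ Δ ⌝ˢ ∷ ⌜ A ⌝ ∷ []))))
      (axK (¬' ⌜ A ⌝) ⌜ Δ ⌝ˢ)

Tb-sound : ∀ A → S5 (⌜ fm (◇ A) ∷ fm A ∷ [] ⌝ˢ ⇒ ⌜ fm (◇ A) ∷ [] ⌝ˢ)
Tb-sound A =
  mp (tautology ((v 1 ⊃ ¬ₛ (v 0)) ⊃ ¬ₛ (v 1) ∨ₛ v 0 ∨ₛ bot ⊃ ¬ₛ (v 1) ∨ₛ bot) (⌜ A ⌝ ∷ □' (¬' ⌜ A ⌝) ∷ []))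
     (axT (¬' ⌜ A ⌝))

-- ¬◇A is necessary (axiom 4 for ¬A), so □(◇A ∨ Δ) gives □Δ unless ◇A holds.
4c-sound : ∀ Δ A → S5 (⌜ fm (◇ A) ∷ ∘⟨ fm (◇ A) ∷ Δ ⟩ ∷ [] ⌝ˢ ⇒ ⌜ fm (◇ A) ∷ ∘⟨ Δ ⟩ ∷ [] ⌝ˢ)
4c-sound Δ A =
  mp₃ (tautology ((¬ₛ (v 0) ⊃ v 3) ⊃ (v 1 ⊃ v 2) ⊃ (v 2 ⊃ v 3 ⊃ v 4) ⊃ v 0 ∨ₛ v 1 ∨ₛ bot ⊃ v 0 ∨ₛ v 4 ∨ₛ bot)
                 (◇A ∷ □' (◇A ∨' ⌜ Δ ⌝ˢ) ∷ □' (¬' ◇A ⇒ ⌜ Δ ⌝ˢ) ∷ □' (¬' ◇A) ∷ □' ⌜ Δ ⌝ˢ ∷ []))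
      (¬◇⇒□¬◇ ⌜ A ⌝)
      (□-mono (tautology (v 0 ∨ₛ v 1 ⊃ ¬ₛ (v 0) ⊃ v 1) (◇A ∷ ⌜ Δ ⌝ˢ ∷ [])))
      (axK (¬' ◇A) ⌜ Δ ⌝ˢ)
  where ◇A = ◇' ⌜ A ⌝

-- The extra ◇A is absorbed: ◇A ⇒ □◇A by axiom 5, and □◇A implies the boxed structure.
5b-sound : ∀ Δ A → S5 (⌜ ∘⟨ Δ ++ (fm (◇ A) ∷ []) ⟩ ∷ fm (◇ A) ∷ [] ⌝ˢ ⇒ ⌜ ∘⟨ Δ ++ (fm (◇ A) ∷ []) ⟩ ∷ [] ⌝ˢ)
5b-sound Δ A =
  mp₂ (tautology ((v 0 ⊃ v 2) ⊃ (v 2 ⊃ v 1) ⊃ v 1 ∨ₛ v 0 ∨ₛ bot ⊃ v 1 ∨ₛ bot)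
                 (◇' ⌜ A ⌝ ∷ □' ⌜ Δ ++ (fm (◇ A) ∷ []) ⌝ˢ ∷ □' (◇' ⌜ A ⌝) ∷ []))
      (ax5 ⌜ A ⌝)
      (□-mono (⇒-trans (tautology (v 0 ⊃ v 1 ∨ₛ v 0 ∨ₛ bot) (◇' ⌜ A ⌝ ∷ ⌜ Δ ⌝ˢ ∷ []))
                       (++-join Δ (fm (◇ A) ∷ []))))

DKS5-sound : ∀ {Γ} → DKS5 Γ → S5 ⌜ Γ ⌝ˢ
DKS5-sound (perm C p d)   = mp (ctx-mono C (↭-sound p)) (DKS5-sound d)
DKS5-sound (id C n)       = ctx-valid C (id-sound n)
DKS5-sound (∧r C A B d e) = mp₂ (ctx-mono₂ C (∧r-sound A B)) (DKS5-sound d) (DKS5-sound e)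
DKS5-sound (∨r C A B d)   = mp (ctx-mono C (∨r-sound A B)) (DKS5-sound d)
DKS5-sound (□r C A d)     = mp (ctx-mono C (□r-sound A)) (DKS5-sound d)
DKS5-sound (◇₁ C Δ A d)   = mp (ctx-mono C (◇₁-sound Δ A)) (DKS5-sound d)
DKS5-sound (Tb C A d)     = mp (ctx-mono C (Tb-sound A)) (DKS5-sound d)
DKS5-sound (4c C Δ A d)   = mp (ctx-mono C (4c-sound Δ A)) (DKS5-sound d)
DKS5-sound (5b C Δ A d)   = mp (ctx-mono C (5b-sound Δ A)) (DKS5-sound d)

soundness : ∀ A (m : Modal A) → DKS5 (fm A ∷ []) → S5 (tr A m)
soundness A m d rewrite tr≡⌜⌝ A m = mp (tautology (v 0 ∨ₛ bot ⊃ v 0) (⌜ A ⌝ ∷ [])) (DKS5-sound d)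

-- Finite universal models

T-→ : ∀ {a b} → (T a → T b) → T (not a ∨ᵇ b)
T-→ {false} _ = _
T-→ {true}  f = f _

T-mp : ∀ {a b} → T (not a ∨ᵇ b) → T a → T b
T-mp {true} t _ = t

module UniversalModel {W : Set} (worlds : List W) (V : W → ℕ → Bool) where

  ⟦_⟧ : HFm → W → Bool
  ⟦ var n ⟧ w = V w n
  ⟦ ⊥' ⟧    w = false
  ⟦ A ⇒ B ⟧ w = not (⟦ A ⟧ w) ∨ᵇ ⟦ B ⟧ w
  ⟦ □' A ⟧  w = all ⟦ A ⟧ worlds

  S5-sound : ∀ {A} → S5 A → ∀ {w} → w ∈ worlds → T (⟦ A ⟧ w)
  S5-sound (ax1 A B) {w} _ with ⟦ A ⟧ w | ⟦ B ⟧ w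
  ... | false | _     = _
  ... | true  | false = _
  ... | true  | true  = _
  S5-sound (ax2 A B C) {w} _ with ⟦ A ⟧ w | ⟦ B ⟧ w | ⟦ C ⟧ w
  ... | false | _     | _     = _
  ... | true  | false | _     = _
  ... | true  | true  | false = _
  ... | true  | true  | true  = _
  S5-sound (ax3 A) {w} _ with ⟦ A ⟧ w
  ... | false = _
  ... | true  = _
  S5-sound (axK A B) _ = T-→ λ □A⇒B → T-→ λ □A →
    all⁻ ⟦ B ⟧ (zipWith (λ (f , a) → T-mp f a) (all⁺ ⟦ A ⇒ B ⟧ worlds □A⇒B , all⁺ ⟦ A ⟧ worlds □A))
  S5-sound (axT A) w∈ = T-→ λ □A → lookup (all⁺ ⟦ A ⟧ worlds □A) w∈
  S5-sound (ax5 A) _ = T-→ λ ◇A → all⁻ ⟦ ◇' A ⟧ (tabulate {xs = worlds} λ _ → ◇A)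
  S5-sound (mp d e) w∈ = T-mp (S5-sound d w∈) (S5-sound e w∈)
  S5-sound (nec {A} d) _ = all⁻ ⟦ A ⟧ (tabulate λ u∈ → S5-sound d u∈)

  -- ■ and ◆ never occur in purely modal formulae; reading them as false
  -- keeps the countermodel condition trivial for them.
  ⟦_⟧ᶠ : Fm → W → Bool
  ⟦ pos n ⟧ᶠ w = V w n
  ⟦ neg n ⟧ᶠ w = not (V w n)
  ⟦ A ∨ B ⟧ᶠ w = ⟦ A ⟧ᶠ w ∨ᵇ ⟦ B ⟧ᶠ w
  ⟦ A ∧ B ⟧ᶠ w = ⟦ A ⟧ᶠ w ∧ᵇ ⟦ B ⟧ᶠ w
  ⟦ □ A ⟧ᶠ   w = all ⟦ A ⟧ᶠ worlds
  ⟦ ■ A ⟧ᶠ   w = false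
  ⟦ ◇ A ⟧ᶠ   w = any ⟦ A ⟧ᶠ worlds
  ⟦ ◆ A ⟧ᶠ   w = false

  ¬all¬≡any : ∀ (f : W → Bool) us → not (all (λ u → not (f u) ∨ᵇ false) us) ∨ᵇ false ≡ any f us
  ¬all¬≡any f []       = refl
  ¬all¬≡any f (u ∷ us) with f u
  ... | true  = refl
  ... | false = ¬all¬≡any f us

  tr-agrees : ∀ A (m : Modal A) w → ⟦ tr A m ⟧ w ≡ ⟦ A ⟧ᶠ w
  tr-agrees _ (pos n) w = refl
  tr-agrees _ (neg n) w with V w n
  ... | true  = refl
  ... | false = refl
  tr-agrees (A ∨ B) (p ∨ q) w rewrite tr-agrees A p w | tr-agrees B q w with ⟦ A ⟧ᶠ w
  ... | true  = refl
  ... | false = refl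
  tr-agrees (A ∧ B) (p ∧ q) w rewrite tr-agrees A p w | tr-agrees B q w with ⟦ A ⟧ᶠ w | ⟦ B ⟧ᶠ w
  ... | true  | true  = refl
  ... | true  | false = refl
  ... | false | _     = refl
  tr-agrees (□ A) (□ p) w = cong and (map-cong (λ u → tr-agrees A p u) worlds)
  tr-agrees (◇ A) (◇ p) w =
    trans (¬all¬≡any ⟦ tr A p ⟧ worlds) (cong or (map-cong (λ u → tr-agrees A p u) worlds))

-- Trees of nested sequents

data Tree : Set where
  node : List Fm → List Tree → Tree

mutual
  ⌊_⌋ : Tree → Seq
  ⌊ node L ts ⌋ = map fm L ++ children ts

  children : List Tree → Seq
  children []       = []
  children (t ∷ ts) = ∘⟨ ⌊ t ⌋ ⟩ ∷ children ts

children-++ : ∀ ts us → children (ts ++ us) ≡ children ts ++ children us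
children-++ []       us = refl
children-++ (t ∷ ts) us = cong (∘⟨ ⌊ t ⌋ ⟩ ∷_) (children-++ ts us)

-- A frame is a node with a hole among its children: label, left siblings, right siblings.
data Frame : Set where
  frame : List Fm → List Tree → List Tree → Frame

Path : Set
Path = List Frame

plug : Path → Tree → Tree
plug []                  t = t
plug (frame L ls rs ∷ p) t = node L (ls ++ plug p t ∷ rs)

plug-∷ʳ : ∀ p L ls rs t → plug (p ++ (frame L ls rs ∷ [])) t ≡ plug p (node L (ls ++ t ∷ rs))
plug-∷ʳ []                     L ls rs t = refl
plug-∷ʳ (frame L′ ls′ rs′ ∷ p) L ls rs t = cong (λ u → node L′ (ls′ ++ u ∷ rs′)) (plug-∷ʳ p L ls rs t)

siblings : List Fm → List Tree → List Tree → Seq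
siblings L ls rs = map fm L ++ children ls ++ children rs

toCtx : Path → Seq → Ctx
toCtx []                  Γ = hole Γ
toCtx (frame L ls rs ∷ p) Γ = ∘ctx (siblings L ls rs) (toCtx p Γ)

toCtx-hole : ∀ p Γ Δ → toCtx p Γ [ Δ ] ≡ toCtx p [] [ Γ ++ Δ ]
toCtx-hole []                  Γ Δ = refl
toCtx-hole (frame L ls rs ∷ p) Γ Δ = cong (λ Π → siblings L ls rs ++ (∘⟨ Π ⟩ ∷ [])) (toCtx-hole p Γ Δ)

infix 3 _≈_

data _≈_ : Seq → Seq → Set where
  perm-at : ∀ C {Γ Δ} → Γ ↭ Δ → C [ Γ ] ≈ C [ Δ ]
  ≈-trans : ∀ {X Y Z} → X ≈ Y → Y ≈ Z → X ≈ Z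

≈-DKS5 : ∀ {X Y} → X ≈ Y → DKS5 X → DKS5 Y
≈-DKS5 (perm-at C p) d = perm C p d
≈-DKS5 (≈-trans e f) d = ≈-DKS5 f (≈-DKS5 e d)

≈-sym : ∀ {X Y} → X ≈ Y → Y ≈ X
≈-sym (perm-at C p) = perm-at C (↭-sym p)
≈-sym (≈-trans e f) = ≈-trans (≈-sym f) (≈-sym e)

↭⇒≈ : ∀ {X Y} → X ↭ Y → X ≈ Y
↭⇒≈ = perm-at (hole [])

≡⇒≈ : ∀ {X Y} → X ≡ Y → X ≈ Y
≡⇒≈ refl = ↭⇒≈ ↭-refl

_⊚_ : Ctx → Ctx → Ctx
hole Γ   ⊚ hole Δ   = hole (Γ ++ Δ)
hole Γ   ⊚ ∘ctx Δ C = ∘ctx (Γ ++ Δ) C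
hole Γ   ⊚ •ctx Δ C = •ctx (Γ ++ Δ) C
∘ctx Γ D ⊚ C        = ∘ctx Γ (D ⊚ C)
•ctx Γ D ⊚ C        = •ctx Γ (D ⊚ C)

⊚-[] : ∀ D C Π → (D ⊚ C) [ Π ] ≡ D [ C [ Π ] ]
⊚-[] (hole Γ)   (hole Δ)   Π = ++-assoc Γ Δ Π
⊚-[] (hole Γ)   (∘ctx Δ C) Π = ++-assoc Γ Δ _
⊚-[] (hole Γ)   (•ctx Δ C) Π = ++-assoc Γ Δ _
⊚-[] (∘ctx Γ D) C          Π = cong (λ Σ → Γ ++ (∘⟨ Σ ⟩ ∷ [])) (⊚-[] D C Π)
⊚-[] (•ctx Γ D) C          Π = cong (λ Σ → Γ ++ (•⟨ Σ ⟩ ∷ [])) (⊚-[] D C Π)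

≈-ctx : ∀ D {X Y} → X ≈ Y → D [ X ] ≈ D [ Y ]
≈-ctx D (perm-at C p) = subst₂ _≈_ (⊚-[] D C _) (⊚-[] D C _) (perm-at (D ⊚ C) p)
≈-ctx D (≈-trans e f) = ≈-trans (≈-ctx D e) (≈-ctx D f)

fm∈⌊⌋ : ∀ {x L} ts → x ∈ L → fm x ∈ ⌊ node L ts ⌋
fm∈⌊⌋ ts x∈ = ∈-++⁺ˡ (∈-map⁺ fm x∈)

middle↭end : ∀ xs (y : Item) ys → xs ++ y ∷ ys ↭ (xs ++ ys) ++ y ∷ []
middle↭end xs y ys = begin
  xs ++ y ∷ ys          ↭⟨ ++⁺ˡ xs (++-comm (y ∷ []) ys) ⟩
  xs ++ ys ++ y ∷ []    ≡⟨ ++-assoc xs ys (y ∷ []) ⟨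
  (xs ++ ys) ++ y ∷ []  ∎
  where open PermutationReasoning

child-to-end : ∀ L ls t rs → ⌊ node L (ls ++ t ∷ rs) ⌋ ↭ siblings L ls rs ++ ∘⟨ ⌊ t ⌋ ⟩ ∷ []
child-to-end L ls t rs = begin
  map fm L ++ children (ls ++ t ∷ rs)
    ≡⟨ cong (map fm L ++_) (children-++ ls (t ∷ rs)) ⟩
  map fm L ++ children ls ++ ∘⟨ ⌊ t ⌋ ⟩ ∷ children rs
    ↭⟨ ++⁺ˡ (map fm L) (middle↭end (children ls) _ (children rs)) ⟩
  map fm L ++ (children ls ++ children rs) ++ ∘⟨ ⌊ t ⌋ ⟩ ∷ []
    ≡⟨ ++-assoc (map fm L) _ _ ⟨
  siblings L ls rs ++ ∘⟨ ⌊ t ⌋ ⟩ ∷ []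
    ∎
  where open PermutationReasoning

add-after : ∀ ys {Γ Γ₀} (z : Item) → Γ ↭ Γ₀ ++ z ∷ [] → ys ++ Γ ↭ Γ₀ ++ z ∷ ys
add-after ys {Γ} {Γ₀} z e = begin
  ys ++ Γ               ↭⟨ ++⁺ˡ ys e ⟩
  ys ++ Γ₀ ++ z ∷ []    ↭⟨ ++-comm ys (Γ₀ ++ z ∷ []) ⟩
  (Γ₀ ++ z ∷ []) ++ ys  ≡⟨ ++-assoc Γ₀ (z ∷ []) ys ⟩
  Γ₀ ++ z ∷ ys          ∎
  where open PermutationReasoning

plug≈ : ∀ p t → ⌊ plug p t ⌋ ≈ toCtx p [] [ ⌊ t ⌋ ]
plug≈ []                  t = ↭⇒≈ ↭-refl
plug≈ (frame L ls rs ∷ p) t =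
  ≈-trans (↭⇒≈ (child-to-end L ls (plug p t) rs)) (≈-ctx (∘ctx (siblings L ls rs) (hole [])) (plug≈ p t))

focus : ∀ p Γ₀ {t Π} → ⌊ t ⌋ ≈ Γ₀ ++ Π → ⌊ plug p t ⌋ ≈ toCtx p Γ₀ [ Π ]
focus p Γ₀ {t} {Π} e =
  ≈-trans (plug≈ p t) (≈-trans (≈-ctx (toCtx p []) e) (≡⇒≈ (sym (toCtx-hole p Γ₀ Π))))

extract : ∀ {y : Item} {Γ} → y ∈ Γ → ∃ λ Γ₀ → Γ ↭ Γ₀ ++ (y ∷ [])
extract y∈ with ys , zs , refl ← ∈-∃++ y∈ = ys ++ zs , middle↭end ys _ zs

module RuleSteps (p : Path) (L : List Fm) (ts : List Tree) where

  open PermutationReasoning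

  fm∈ : ∀ {x} → x ∈ L → fm x ∈ ⌊ node L ts ⌋
  fm∈ = fm∈⌊⌋ ts

  id-step : ∀ n → pos n ∈ L → neg n ∈ L → DKS5 ⌊ plug p (node L ts) ⌋
  id-step n pos∈ neg∈ with Γ₁ , e₁ ← extract (fm∈ pos∈) with ∈-++⁻ Γ₁ (∈-resp-↭ e₁ (fm∈ neg∈))
  ... | inj₂ (here ())
  ... | inj₁ neg∈Γ₁ with Γ₀ , e₀ ← extract neg∈Γ₁ =
    ≈-DKS5 (≈-sym (focus p Γ₀ (↭⇒≈ both-last))) (id (toCtx p Γ₀) n)
    where
    both-last : ⌊ node L ts ⌋ ↭ Γ₀ ++ fm (pos n) ∷ fm (neg n) ∷ []
    both-last = begin
      ⌊ node L ts ⌋                               ↭⟨ e₁ ⟩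
      Γ₁ ++ fm (pos n) ∷ []                       ↭⟨ ++⁺ʳ _ e₀ ⟩
      (Γ₀ ++ fm (neg n) ∷ []) ++ fm (pos n) ∷ []  ≡⟨ ++-assoc Γ₀ _ _ ⟩
      Γ₀ ++ fm (neg n) ∷ fm (pos n) ∷ []          ↭⟨ ++⁺ˡ Γ₀ (swap _ _ ↭-refl) ⟩
      Γ₀ ++ fm (pos n) ∷ fm (neg n) ∷ []          ∎

  ∨-step : ∀ A B → A ∨ B ∈ L → DKS5 ⌊ plug p (node (A ∷ B ∷ L) ts) ⌋ → DKS5 ⌊ plug p (node L ts) ⌋
  ∨-step A B ∨∈ d with Γ₀ , e ← extract (fm∈ ∨∈) =
    ≈-DKS5 (≈-sym (focus p Γ₀ (↭⇒≈ e)))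
      (∨r (toCtx p Γ₀) A B (≈-DKS5 (focus p Γ₀ (↭⇒≈ (add-after (fm A ∷ fm B ∷ []) _ e))) d))

  ∧-step : ∀ A B → A ∧ B ∈ L → DKS5 ⌊ plug p (node (A ∷ L) ts) ⌋ → DKS5 ⌊ plug p (node (B ∷ L) ts) ⌋ →
           DKS5 ⌊ plug p (node L ts) ⌋
  ∧-step A B ∧∈ d₁ d₂ with Γ₀ , e ← extract (fm∈ ∧∈) =
    ≈-DKS5 (≈-sym (focus p Γ₀ (↭⇒≈ e)))
      (∧r (toCtx p Γ₀) A B (≈-DKS5 (focus p Γ₀ (↭⇒≈ (add-after (fm A ∷ []) _ e))) d₁)
                           (≈-DKS5 (focus p Γ₀ (↭⇒≈ (add-after (fm B ∷ []) _ e))) d₂))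

  Tb-step : ∀ A → ◇ A ∈ L → DKS5 ⌊ plug p (node (A ∷ L) ts) ⌋ → DKS5 ⌊ plug p (node L ts) ⌋
  Tb-step A ◇∈ d with Γ₀ , e ← extract (fm∈ ◇∈) =
    ≈-DKS5 (≈-sym (focus p Γ₀ (↭⇒≈ e)))
      (Tb (toCtx p Γ₀) A (≈-DKS5 (focus p Γ₀ (↭⇒≈ (add-after (fm A ∷ []) _ e))) d))

  □-step : ∀ A → □ A ∈ L → DKS5 ⌊ plug p (node L (node (A ∷ []) [] ∷ ts)) ⌋ → DKS5 ⌊ plug p (node L ts) ⌋
  □-step A □∈ d with Γ₀ , e ← extract (fm∈ □∈) =
    ≈-DKS5 (≈-sym (focus p Γ₀ (↭⇒≈ e)))
      (□r (toCtx p Γ₀) A (≈-DKS5 (focus p Γ₀ (↭⇒≈ new-child-last)) d))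
    where
    new-child-last : ⌊ node L (node (A ∷ []) [] ∷ ts) ⌋ ↭ Γ₀ ++ fm (□ A) ∷ ∘⟨ fm A ∷ [] ⟩ ∷ []
    new-child-last = begin
      map fm L ++ ∘⟨ fm A ∷ [] ⟩ ∷ children ts ↭⟨ shift _ (map fm L) (children ts) ⟩
      ∘⟨ fm A ∷ [] ⟩ ∷ ⌊ node L ts ⌋           ↭⟨ add-after (∘⟨ fm A ∷ [] ⟩ ∷ []) _ e ⟩
      Γ₀ ++ fm (□ A) ∷ ∘⟨ fm A ∷ [] ⟩ ∷ []     ∎

module ChildSteps (p : Path) (L : List Fm) (ls rs : List Tree) where

  open PermutationReasoning

  4c-step : ∀ A Lc tsc → ◇ A ∈ L → DKS5 ⌊ plug p (node L (ls ++ node (◇ A ∷ Lc) tsc ∷ rs)) ⌋ →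
            DKS5 ⌊ plug p (node L (ls ++ node Lc tsc ∷ rs)) ⌋
  4c-step A Lc tsc ◇∈ d with Γ₀ , e ← extract {Γ = siblings L ls rs} (∈-++⁺ˡ (∈-map⁺ fm ◇∈)) =
    ≈-DKS5 (≈-sym (focus p Γ₀ (↭⇒≈ (◇A-and-child (node Lc tsc)))))
      (4c (toCtx p Γ₀) ⌊ node Lc tsc ⌋ A (≈-DKS5 (focus p Γ₀ (↭⇒≈ (◇A-and-child (node (◇ A ∷ Lc) tsc)))) d))
    where
    ◇A-and-child : ∀ t → ⌊ node L (ls ++ t ∷ rs) ⌋ ↭ Γ₀ ++ fm (◇ A) ∷ ∘⟨ ⌊ t ⌋ ⟩ ∷ []
    ◇A-and-child t = begin
      ⌊ node L (ls ++ t ∷ rs) ⌋                    ↭⟨ child-to-end L ls t rs ⟩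
      siblings L ls rs ++ ∘⟨ ⌊ t ⌋ ⟩ ∷ []           ↭⟨ ++⁺ʳ _ e ⟩
      (Γ₀ ++ fm (◇ A) ∷ []) ++ ∘⟨ ⌊ t ⌋ ⟩ ∷ []      ≡⟨ ++-assoc Γ₀ _ _ ⟩
      Γ₀ ++ fm (◇ A) ∷ ∘⟨ ⌊ t ⌋ ⟩ ∷ []              ∎

  5b-step : ∀ A Lc tsc → ◇ A ∈ Lc → DKS5 ⌊ plug p (node (◇ A ∷ L) (ls ++ node Lc tsc ∷ rs)) ⌋ →
            DKS5 ⌊ plug p (node L (ls ++ node Lc tsc ∷ rs)) ⌋
  5b-step A Lc tsc ◇∈ d with Δ , e ← extract (fm∈⌊⌋ tsc ◇∈) =
    ≈-DKS5 (≈-sym (focus p Γ (≈-trans (↭⇒≈ (child-to-end L ls _ rs)) (child≈ Γ))))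
      (5b (toCtx p Γ) Δ A (≈-DKS5 (focus p Γ premise≈) d))
    where
    Γ = siblings L ls rs
    child≈ : ∀ Γ′ → Γ′ ++ ∘⟨ ⌊ node Lc tsc ⌋ ⟩ ∷ [] ≈ Γ′ ++ ∘⟨ Δ ++ fm (◇ A) ∷ [] ⟩ ∷ []
    child≈ Γ′ = ≈-ctx (∘ctx Γ′ (hole [])) (↭⇒≈ e)
    premise≈ : ⌊ node (◇ A ∷ L) (ls ++ node Lc tsc ∷ rs) ⌋ ≈ Γ ++ ∘⟨ Δ ++ fm (◇ A) ∷ [] ⟩ ∷ fm (◇ A) ∷ []
    premise≈ = ≈-trans (↭⇒≈ (prep _ (child-to-end L ls _ rs)))
                 (≈-trans (child≈ (fm (◇ A) ∷ Γ)) (↭⇒≈ (add-after (fm (◇ A) ∷ []) _ ↭-refl)))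

infix 4 _≟ᶠ_

_≟ᶠ_ : DecidableEquality Fm
pos m     ≟ᶠ pos n     = map′ (cong pos) (λ { refl → refl }) (m ≟ n)
pos m     ≟ᶠ neg n     = no λ ()
pos m     ≟ᶠ (B₁ ∨ B₂) = no λ ()
pos m     ≟ᶠ (B₁ ∧ B₂) = no λ ()
pos m     ≟ᶠ □ B       = no λ ()
pos m     ≟ᶠ ■ B       = no λ ()
pos m     ≟ᶠ ◇ B       = no λ ()
pos m     ≟ᶠ ◆ B       = no λ ()
neg m     ≟ᶠ pos n     = no λ ()
neg m     ≟ᶠ neg n     = map′ (cong neg) (λ { refl → refl }) (m ≟ n)
neg m     ≟ᶠ (B₁ ∨ B₂) = no λ ()
neg m     ≟ᶠ (B₁ ∧ B₂) = no λ ()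
neg m     ≟ᶠ □ B       = no λ ()
neg m     ≟ᶠ ■ B       = no λ ()
neg m     ≟ᶠ ◇ B       = no λ ()
neg m     ≟ᶠ ◆ B       = no λ ()
(A₁ ∨ A₂) ≟ᶠ pos n     = no λ ()
(A₁ ∨ A₂) ≟ᶠ neg n     = no λ ()
(A₁ ∨ A₂) ≟ᶠ (B₁ ∨ B₂) = map′ (λ { (refl , refl) → refl }) (λ { refl → refl , refl }) ((A₁ ≟ᶠ B₁) ×-dec (A₂ ≟ᶠ B₂))
(A₁ ∨ A₂) ≟ᶠ (B₁ ∧ B₂) = no λ ()
(A₁ ∨ A₂) ≟ᶠ □ B       = no λ ()
(A₁ ∨ A₂) ≟ᶠ ■ B       = no λ ()
(A₁ ∨ A₂) ≟ᶠ ◇ B       = no λ ()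
(A₁ ∨ A₂) ≟ᶠ ◆ B       = no λ ()
(A₁ ∧ A₂) ≟ᶠ pos n     = no λ ()
(A₁ ∧ A₂) ≟ᶠ neg n     = no λ ()
(A₁ ∧ A₂) ≟ᶠ (B₁ ∨ B₂) = no λ ()
(A₁ ∧ A₂) ≟ᶠ (B₁ ∧ B₂) = map′ (λ { (refl , refl) → refl }) (λ { refl → refl , refl }) ((A₁ ≟ᶠ B₁) ×-dec (A₂ ≟ᶠ B₂))
(A₁ ∧ A₂) ≟ᶠ □ B       = no λ ()
(A₁ ∧ A₂) ≟ᶠ ■ B       = no λ ()
(A₁ ∧ A₂) ≟ᶠ ◇ B       = no λ ()
(A₁ ∧ A₂) ≟ᶠ ◆ B       = no λ ()
□ A       ≟ᶠ pos n     = no λ ()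
□ A       ≟ᶠ neg n     = no λ ()
□ A       ≟ᶠ (B₁ ∨ B₂) = no λ ()
□ A       ≟ᶠ (B₁ ∧ B₂) = no λ ()
□ A       ≟ᶠ □ B       = map′ (cong □) (λ { refl → refl }) (A ≟ᶠ B)
□ A       ≟ᶠ ■ B       = no λ ()
□ A       ≟ᶠ ◇ B       = no λ ()
□ A       ≟ᶠ ◆ B       = no λ ()
■ A       ≟ᶠ pos n     = no λ ()
■ A       ≟ᶠ neg n     = no λ ()
■ A       ≟ᶠ (B₁ ∨ B₂) = no λ ()
■ A       ≟ᶠ (B₁ ∧ B₂) = no λ ()
■ A       ≟ᶠ □ B       = no λ ()
■ A       ≟ᶠ ■ B       = map′ (cong ■) (λ { refl → refl }) (A ≟ᶠ B)
■ A       ≟ᶠ ◇ B       = no λ ()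
■ A       ≟ᶠ ◆ B       = no λ ()
◇ A       ≟ᶠ pos n     = no λ ()
◇ A       ≟ᶠ neg n     = no λ ()
◇ A       ≟ᶠ (B₁ ∨ B₂) = no λ ()
◇ A       ≟ᶠ (B₁ ∧ B₂) = no λ ()
◇ A       ≟ᶠ □ B       = no λ ()
◇ A       ≟ᶠ ■ B       = no λ ()
◇ A       ≟ᶠ ◇ B       = map′ (cong ◇) (λ { refl → refl }) (A ≟ᶠ B)
◇ A       ≟ᶠ ◆ B       = no λ ()
◆ A       ≟ᶠ pos n     = no λ ()
◆ A       ≟ᶠ neg n     = no λ ()
◆ A       ≟ᶠ (B₁ ∨ B₂) = no λ ()
◆ A       ≟ᶠ (B₁ ∧ B₂) = no λ ()
◆ A       ≟ᶠ □ B       = no λ ()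
◆ A       ≟ᶠ ■ B       = no λ ()
◆ A       ≟ᶠ ◇ B       = no λ ()
◆ A       ≟ᶠ ◆ B       = map′ (cong ◆) (λ { refl → refl }) (A ≟ᶠ B)

open import Data.List.Membership.DecPropositional _≟ᶠ_ using (_∈?_)

mutual
  labels : Tree → List (List Fm)
  labels (node L ts) = L ∷ labels* ts

  labels* : List Tree → List (List Fm)
  labels* []       = []
  labels* (t ∷ ts) = labels t ++ labels* ts

root : Tree → List Fm
root (node L _) = L

labels*-++ : ∀ ts us → labels* (ts ++ us) ≡ labels* ts ++ labels* us
labels*-++ []       us = refl
labels*-++ (t ∷ ts) us = trans (cong (labels t ++_) (labels*-++ ts us)) (sym (++-assoc (labels t) _ _))

above : Path → List (List Fm)
above []                  = []
above (frame L ls rs ∷ p) = L ∷ labels* ls ++ above p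

below : Path → List (List Fm)
below []                  = []
below (frame L ls rs ∷ p) = below p ++ labels* rs

labels-plug : ∀ p t → labels (plug p t) ≡ above p ++ labels t ++ below p
labels-plug []                  t = sym (++-identityʳ (labels t))
labels-plug (frame L ls rs ∷ p) t = cong (L ∷_) (begin
  labels* (ls ++ plug p t ∷ rs)
    ≡⟨ labels*-++ ls (plug p t ∷ rs) ⟩
  labels* ls ++ labels (plug p t) ++ labels* rs
    ≡⟨ cong (λ G → labels* ls ++ G ++ labels* rs) (labels-plug p t) ⟩
  labels* ls ++ (above p ++ labels t ++ below p) ++ labels* rs
    ≡⟨ cong (labels* ls ++_) (++-assoc (above p) _ _) ⟩
  labels* ls ++ above p ++ (labels t ++ below p) ++ labels* rs
    ≡⟨ cong (λ G → labels* ls ++ above p ++ G) (++-assoc (labels t) _ _) ⟩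
  labels* ls ++ above p ++ labels t ++ below p ++ labels* rs
    ≡⟨ ++-assoc (labels* ls) (above p) _ ⟨
  (labels* ls ++ above p) ++ labels t ++ below p ++ labels* rs
    ∎)
  where open ≡-Reasoning

Occurs : Fm → List (List Fm) → Set
Occurs x G = Any (x ∈_) G

-- G is the list of all labels of the tree.  The labels become the worlds of a universal
-- model, so □A is refuted at any label as soon as A occurs in some label.
Saturated-at : List (List Fm) → List Fm → List Tree → Fm → Set
Saturated-at G L ts (pos n) = ¬ neg n ∈ L
Saturated-at G L ts (neg n) = ⊤
Saturated-at G L ts (A ∨ B) = A ∈ L × B ∈ L
Saturated-at G L ts (A ∧ B) = A ∈ L ⊎ B ∈ L
Saturated-at G L ts (□ A)   = Occurs A G
Saturated-at G L ts (■ A)   = ⊤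
Saturated-at G L ts (◇ A)   = A ∈ L × All (λ t → ◇ A ∈ root t) ts
Saturated-at G L ts (◆ A)   = ⊤

◇-in : List Fm → Fm → Set
◇-in L (◇ A)   = ◇ A ∈ L
◇-in L (pos n) = ⊤
◇-in L (neg n) = ⊤
◇-in L (A ∨ B) = ⊤
◇-in L (A ∧ B) = ⊤
◇-in L (□ A)   = ⊤
◇-in L (■ A)   = ⊤
◇-in L (◆ A)   = ⊤

SaturatedNode : List (List Fm) → List Fm → List Tree → Set
SaturatedNode G L ts = All (Saturated-at G L ts) L × All (λ t → All (◇-in L) (root t)) ts

mutual
  Saturated : List (List Fm) → Tree → Set
  Saturated G (node L ts) = SaturatedNode G L ts × Saturated* G ts

  Saturated* : List (List Fm) → List Tree → Set
  Saturated* G []       = ⊤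
  Saturated* G (t ∷ ts) = Saturated G t × Saturated* G ts

mutual
  saturated-node : ∀ {G} t → Saturated G t → ∀ {L} → L ∈ labels t → ∃ λ ts → SaturatedNode G L ts
  saturated-node (node L ts) (sat , _)  (here refl) = ts , sat
  saturated-node (node L ts) (_ , sat*) (there L∈)  = saturated-node* ts sat* L∈

  saturated-node* : ∀ {G} ts → Saturated* G ts → ∀ {L} → L ∈ labels* ts → ∃ λ us → SaturatedNode G L us
  saturated-node* (t ∷ ts) (sat , sat*) L∈ with ∈-++⁻ (labels t) L∈
  ... | inj₁ L∈t  = saturated-node t sat L∈t
  ... | inj₂ L∈ts = saturated-node* ts sat* L∈ts

mutual
  ◇-to-root : ∀ {G} t → Saturated G t → ∀ {L A} → L ∈ labels t → ◇ A ∈ L → ◇ A ∈ root t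
  ◇-to-root (node L ts) _                 (here refl) ◇∈ = ◇∈
  ◇-to-root (node L ts) ((_ , up) , sat*) (there L∈)  ◇∈ = ◇-to-parent ts sat* up L∈ ◇∈

  ◇-to-parent : ∀ {G L₀} ts → Saturated* G ts → All (λ t → All (◇-in L₀) (root t)) ts →
                ∀ {L A} → L ∈ labels* ts → ◇ A ∈ L → ◇ A ∈ L₀
  ◇-to-parent (t ∷ ts) (sat , sat*) (up ∷ ups) L∈ ◇∈ with ∈-++⁻ (labels t) L∈
  ... | inj₁ L∈t  = lookup up (◇-to-root t sat L∈t ◇∈)
  ... | inj₂ L∈ts = ◇-to-parent ts sat* ups L∈ts ◇∈

mutual
  ◇-from-root : ∀ {G} t → Saturated G t → ∀ {L A} → ◇ A ∈ root t → L ∈ labels t → ◇ A ∈ L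
  ◇-from-root (node L ts) _                  ◇∈ (here refl) = ◇∈
  ◇-from-root (node L ts) ((sat , _) , sat*) ◇∈ (there L∈)  = ◇-to-children ts sat* (proj₂ (lookup sat ◇∈)) L∈

  ◇-to-children : ∀ {G} ts → Saturated* G ts → ∀ {A} → All (λ t → ◇ A ∈ root t) ts →
                  ∀ {L} → L ∈ labels* ts → ◇ A ∈ L
  ◇-to-children (t ∷ ts) (sat , sat*) (◇∈ ∷ ◇∈s) L∈ with ∈-++⁻ (labels t) L∈
  ... | inj₁ L∈t  = ◇-from-root t sat ◇∈ L∈t
  ... | inj₂ L∈ts = ◇-to-children ts sat* ◇∈s L∈ts

-- The 5b condition carries a diamond up to the root and the 4c condition back down,
-- so its body is present in every label.
◇-everywhere : ∀ t → Saturated (labels t) t → ∀ {L₁ L₂ A} → L₁ ∈ labels t → ◇ A ∈ L₁ → L₂ ∈ labels t → A ∈ L₂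
◇-everywhere t sat L₁∈ ◇∈ L₂∈ with _ , sat₂ , _ ← saturated-node t sat L₂∈ =
  proj₁ (lookup sat₂ (◇-from-root t sat (◇-to-root t sat L₁∈ ◇∈) L₂∈))

-- Proof search

Occurs? : ∀ x G → Dec (Occurs x G)
Occurs? x G = any? (x ∈?_) G

missing : {P : Fm → Set} → (∀ x → Dec (P x)) → List Fm → ℕ
missing P? []       = 0
missing P? (x ∷ xs) with P? x
... | yes _ = missing P? xs
... | no  _ = suc (missing P? xs)

module _ {P Q : Fm → Set} (P? : ∀ x → Dec (P x)) (Q? : ∀ x → Dec (Q x)) (P⊆Q : P ⊆ Q) where

  missing-mono : ∀ xs → missing Q? xs ≤ missing P? xs
  missing-mono []       = z≤n
  missing-mono (x ∷ xs) with P? x | Q? x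
  ... | yes Px | yes _  = missing-mono xs
  ... | yes Px | no ¬Qx = ⊥-elim (¬Qx (P⊆Q Px))
  ... | no _   | yes _  = m≤n⇒m≤1+n (missing-mono xs)
  ... | no _   | no _   = s≤s (missing-mono xs)

  missing-strict : ∀ xs {y} → y ∈ xs → Q y → ¬ P y → missing Q? xs < missing P? xs
  missing-strict (x ∷ xs) (here refl) Qy ¬Py with P? x | Q? x
  ... | yes Py | _      = ⊥-elim (¬Py Py)
  ... | no _   | no ¬Qy = ⊥-elim (¬Qy Qy)
  ... | no _   | yes _  = s≤s (missing-mono xs)
  missing-strict (x ∷ xs) (there y∈) Qy ¬Py with P? x | Q? x
  ... | yes Px | yes _  = missing-strict xs y∈ Qy ¬Py
  ... | yes Px | no ¬Qx = ⊥-elim (¬Qx (P⊆Q Px))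
  ... | no _   | yes _  = m≤n⇒m≤1+n (missing-strict xs y∈ Qy ¬Py)
  ... | no _   | no _   = s≤s (missing-strict xs y∈ Qy ¬Py)

record SubformulaClosed (S : List Fm) : Set where
  field
    ∨-closed : ∀ {A B} → A ∨ B ∈ S → A ∈ S × B ∈ S
    ∧-closed : ∀ {A B} → A ∧ B ∈ S → A ∈ S × B ∈ S
    □-closed : ∀ {A} → □ A ∈ S → A ∈ S
    ◇-closed : ∀ {A} → ◇ A ∈ S → A ∈ S

all-or : ∀ {A : Set} {P : A → Set} {Q : Set} xs → (∀ x → x ∈ xs → P x ⊎ Q) → All P xs ⊎ Q
all-or []       f = inj₁ []
all-or (x ∷ xs) f with f x (here refl)
... | inj₂ q = inj₂ q
... | inj₁ px with all-or xs (λ y y∈ → f y (there y∈))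
...   | inj₁ pxs = inj₁ (px ∷ pxs)
...   | inj₂ q   = inj₂ q

all-or-split : ∀ {A : Set} {P : A → Set} {Q : Set} xs → (∀ ls x rs → ls ++ x ∷ rs ≡ xs → P x ⊎ Q) → All P xs ⊎ Q
all-or-split {P = P} {Q = Q} xs f = go [] xs refl
  where
  go : ∀ ls rs → ls ++ rs ≡ xs → All P rs ⊎ Q
  go ls []       _ = inj₁ []
  go ls (x ∷ rs) e with f ls x rs e
  ... | inj₂ q = inj₂ q
  ... | inj₁ px with go (ls ++ x ∷ []) rs (trans (++-assoc ls (x ∷ []) rs) e)
  ...   | inj₁ prs = inj₁ (px ∷ prs)
  ...   | inj₂ q   = inj₂ q

_<ₗₑₓ_ : ℕ × ℕ → ℕ × ℕ → Set
_<ₗₑₓ_ = ×-Lex _≡_ _<_ _<_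

<ₗₑₓ-wellFounded : WellFounded _<ₗₑₓ_
<ₗₑₓ-wellFounded = ×-wellFounded <-wellFounded <-wellFounded

module Search (S : List Fm) (S-closed : SubformulaClosed S) where

  open SubformulaClosed S-closed

  Within : List (List Fm) → Set
  Within G = ∀ {L x} → L ∈ G → x ∈ L → x ∈ S

  unused : List (List Fm) → ℕ
  unused G = missing (λ x → Occurs? x G) S

  gaps : List (List Fm) → ℕ
  gaps []      = 0
  gaps (L ∷ G) = missing (_∈? L) S + gaps G

  gaps-++ : ∀ G H → gaps (G ++ H) ≡ gaps G + gaps H
  gaps-++ []      H = refl
  gaps-++ (L ∷ G) H = trans (cong (missing (_∈? L) S +_) (gaps-++ G H)) (sym (+-assoc (missing (_∈? L) S) _ _))

  -- Adding formulas to a label lowers the gaps without raising the unused count;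
  -- the □ rule adds a whole new label, which only lowers the unused count.
  measure : List (List Fm) → ℕ × ℕ
  measure G = unused G , gaps G

  record Progress (G G′ : List (List Fm)) : Set where
    field
      keeps     : ∀ {x} → Occurs x G → Occurs x G′
      within    : Within G′
      decreases : measure G′ <ₗₑₓ measure G
  open Progress

  grow-label : ∀ P L R ys {y} → Within (P ++ L ∷ R) → (∀ {z} → z ∈ ys → z ∈ S) → y ∈ ys → ¬ y ∈ L →
               Progress (P ++ L ∷ R) (P ++ (ys ++ L) ∷ R)
  grow-label P L R ys {y} w ys⊆S y∈ys y∉L = record { keeps = keeps′ ; within = within′ ; decreases = decreases′ }
    where
    keeps′ : ∀ {x} → Occurs x (P ++ L ∷ R) → Occurs x (P ++ (ys ++ L) ∷ R)
    keeps′ o with Anyₚ.++⁻ P o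
    ... | inj₁ o′         = Anyₚ.++⁺ˡ o′
    ... | inj₂ (here x∈)  = Anyₚ.++⁺ʳ P (here (∈-++⁺ʳ ys x∈))
    ... | inj₂ (there o′) = Anyₚ.++⁺ʳ P (there o′)
    within′ : Within (P ++ (ys ++ L) ∷ R)
    within′ L′∈ x∈ with ∈-++⁻ P L′∈
    ... | inj₁ L′∈P          = w (∈-++⁺ˡ L′∈P) x∈
    ... | inj₂ (there L′∈R)  = w (∈-++⁺ʳ P (there L′∈R)) x∈
    ... | inj₂ (here refl) with ∈-++⁻ ys x∈
    ...   | inj₁ x∈ys = ys⊆S x∈ys
    ...   | inj₂ x∈L  = w (∈-++⁺ʳ P (here refl)) x∈L
    fewer-gaps : gaps (P ++ (ys ++ L) ∷ R) < gaps (P ++ L ∷ R)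
    fewer-gaps rewrite gaps-++ P ((ys ++ L) ∷ R) | gaps-++ P (L ∷ R) =
      +-monoʳ-< (gaps P) (+-monoˡ-< (gaps R)
        (missing-strict (_∈? L) (_∈? (ys ++ L)) (∈-++⁺ʳ ys) S (ys⊆S y∈ys) (∈-++⁺ˡ y∈ys) y∉L))
    decreases′ : measure (P ++ (ys ++ L) ∷ R) <ₗₑₓ measure (P ++ L ∷ R)
    decreases′ with m≤n⇒m<n∨m≡n (missing-mono (λ x → Occurs? x (P ++ L ∷ R)) (λ x → Occurs? x _) keeps′ S)
    ... | inj₁ fewer = inj₁ fewer
    ... | inj₂ same  = inj₂ (same , fewer-gaps)

  new-label : ∀ P L R A → Within (P ++ L ∷ R) → A ∈ S → ¬ Occurs A (P ++ L ∷ R) →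
              Progress (P ++ L ∷ R) (P ++ L ∷ (A ∷ []) ∷ R)
  new-label P L R A w A∈S A∉ = record { keeps = keeps′ ; within = within′ ; decreases = inj₁ fewer }
    where
    keeps′ : ∀ {x} → Occurs x (P ++ L ∷ R) → Occurs x (P ++ L ∷ (A ∷ []) ∷ R)
    keeps′ o with Anyₚ.++⁻ P o
    ... | inj₁ o′         = Anyₚ.++⁺ˡ o′
    ... | inj₂ (here x∈)  = Anyₚ.++⁺ʳ P (here x∈)
    ... | inj₂ (there o′) = Anyₚ.++⁺ʳ P (there (there o′))
    within′ : Within (P ++ L ∷ (A ∷ []) ∷ R)
    within′ L′∈ x∈ with ∈-++⁻ P L′∈
    ... | inj₁ L′∈P                 = w (∈-++⁺ˡ L′∈P) x∈
    ... | inj₂ (here refl)          = w (∈-++⁺ʳ P (here refl)) x∈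
    ... | inj₂ (there (there L′∈R)) = w (∈-++⁺ʳ P (there L′∈R)) x∈
    ... | inj₂ (there (here refl)) with x∈
    ...   | here refl = A∈S
    fewer : unused (P ++ L ∷ (A ∷ []) ∷ R) < unused (P ++ L ∷ R)
    fewer = missing-strict (λ x → Occurs? x (P ++ L ∷ R)) (λ x → Occurs? x _) keeps′ S A∈S
              (Anyₚ.++⁺ʳ P (there (here (here refl)))) A∉

  grow-node : ∀ p L ts ys {y} → Within (labels (plug p (node L ts))) → (∀ {z} → z ∈ ys → z ∈ S) →
              y ∈ ys → ¬ y ∈ L → Progress (labels (plug p (node L ts))) (labels (plug p (node (ys ++ L) ts)))
  grow-node p L ts ys w ys⊆S y∈ys y∉L =
    subst₂ Progress (sym (labels-plug p (node L ts))) (sym (labels-plug p (node (ys ++ L) ts)))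
      (grow-label (above p) L (labels* ts ++ below p) ys (subst Within (labels-plug p (node L ts)) w) ys⊆S y∈ys y∉L)

  new-child : ∀ p L ts A → Within (labels (plug p (node L ts))) → A ∈ S → ¬ Occurs A (labels (plug p (node L ts))) →
              Progress (labels (plug p (node L ts))) (labels (plug p (node L (node (A ∷ []) [] ∷ ts))))
  new-child p L ts A w A∈S A∉ =
    subst₂ Progress (sym (labels-plug p (node L ts))) (sym (labels-plug p (node L (node (A ∷ []) [] ∷ ts))))
      (new-label (above p) L (labels* ts ++ below p) A (subst Within (labels-plug p (node L ts)) w) A∈S
         (λ o → A∉ (subst (Occurs A) (sym (labels-plug p (node L ts))) o)))

  data Expansion (t : Tree) : Set where
    closed  : DKS5 ⌊ t ⌋ → Expansion t
    expand₁ : ∀ t′ → Progress (labels t) (labels t′) → (DKS5 ⌊ t′ ⌋ → DKS5 ⌊ t ⌋) → Expansion t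
    expand₂ : ∀ t₁ t₂ → Progress (labels t) (labels t₁) → Progress (labels t) (labels t₂) →
              (DKS5 ⌊ t₁ ⌋ → DKS5 ⌊ t₂ ⌋ → DKS5 ⌊ t ⌋) → Expansion t

  module Check (t : Tree) (w : Within (labels t)) where

    in-S : ∀ p L ts → plug p (node L ts) ≡ t → ∀ {x} → x ∈ L → x ∈ S
    in-S p L ts refl = w (subst (L ∈_) (sym (labels-plug p (node L ts))) (∈-++⁺ʳ (above p) (here refl)))

    add-formula : ∀ p L ts {A} → plug p (node L ts) ≡ t → A ∈ S → ¬ A ∈ L →
                  Progress (labels t) (labels (plug p (node (A ∷ L) ts)))
    add-formula p L ts refl A∈S A∉ = grow-node p L ts (_ ∷ []) w (λ { (here refl) → A∈S }) (here refl) A∉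

    ∨-expansion : ∀ p L ts A B → A ∨ B ∈ L → plug p (node L ts) ≡ t → ∀ {y} → y ∈ A ∷ B ∷ [] → ¬ y ∈ L → Expansion t
    ∨-expansion p L ts A B ∨∈ refl y∈ y∉ =
      expand₁ _ (grow-node p L ts (A ∷ B ∷ []) w both∈S y∈ y∉) (RuleSteps.∨-step p L ts A B ∨∈)
      where
      both∈S : ∀ {z} → z ∈ A ∷ B ∷ [] → z ∈ S
      both∈S (here refl)         = proj₁ (∨-closed (in-S p L ts refl ∨∈))
      both∈S (there (here refl)) = proj₂ (∨-closed (in-S p L ts refl ∨∈))

    check-4c : ∀ p L ts A → ◇ A ∈ L → plug p (node L ts) ≡ t →
               ∀ ls c rs → ls ++ c ∷ rs ≡ ts → ◇ A ∈ root c ⊎ Expansion t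
    check-4c p L _ A ◇∈ refl ls (node Lc tsc) rs refl with ◇ A ∈? Lc
    ... | yes ◇∈c = inj₁ ◇∈c
    ... | no  ◇∉c = inj₂ (expand₁ _ (add-formula p′ Lc tsc plug-child ◇A∈S ◇∉c)
                                   (ChildSteps.4c-step p L ls rs A Lc tsc ◇∈
                                      ∘ subst (DKS5 ∘ ⌊_⌋) (plug-∷ʳ p L ls rs _)))
      where
      p′ = p ++ frame L ls rs ∷ []
      plug-child = plug-∷ʳ p L ls rs (node Lc tsc)
      ◇A∈S = in-S p L _ refl ◇∈

    check-5b : ∀ p L ts → plug p (node L ts) ≡ t → ∀ ls c rs → ls ++ c ∷ rs ≡ ts → All (◇-in L) (root c) ⊎ Expansion t
    check-5b p L _ refl ls (node Lc tsc) rs refl = all-or Lc inherited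
      where
      plug-child = plug-∷ʳ p L ls rs (node Lc tsc)
      inherited : ∀ x → x ∈ Lc → ◇-in L x ⊎ Expansion (plug p (node L (ls ++ node Lc tsc ∷ rs)))
      inherited (◇ A) ◇∈c with ◇ A ∈? L
      ... | yes ◇∈ = inj₁ ◇∈
      ... | no  ◇∉ = inj₂ (expand₁ _ (add-formula p L _ refl ◇A∈S ◇∉)
                                     (ChildSteps.5b-step p L ls rs A Lc tsc ◇∈c))
        where ◇A∈S = in-S (p ++ frame L ls rs ∷ []) Lc tsc plug-child ◇∈c
      inherited (pos n) _ = inj₁ tt
      inherited (neg n) _ = inj₁ tt
      inherited (A ∨ B) _ = inj₁ tt
      inherited (A ∧ B) _ = inj₁ tt
      inherited (□ A)   _ = inj₁ tt
      inherited (■ A)   _ = inj₁ tt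
      inherited (◆ A)   _ = inj₁ tt

    check-formula : ∀ p L ts → plug p (node L ts) ≡ t → ∀ x → x ∈ L → Saturated-at (labels t) L ts x ⊎ Expansion t
    check-formula p L ts refl (pos n) pos∈ with neg n ∈? L
    ... | yes neg∈ = inj₂ (closed (RuleSteps.id-step p L ts n pos∈ neg∈))
    ... | no  neg∉ = inj₁ neg∉
    check-formula p L ts refl (neg n) _ = inj₁ tt
    check-formula p L ts refl (A ∨ B) ∨∈ with A ∈? L | B ∈? L
    ... | yes A∈ | yes B∈ = inj₁ (A∈ , B∈)
    ... | no  A∉ | _      = inj₂ (∨-expansion p L ts A B ∨∈ refl (here refl) A∉)
    ... | yes _  | no  B∉ = inj₂ (∨-expansion p L ts A B ∨∈ refl (there (here refl)) B∉)
    check-formula p L ts refl (A ∧ B) ∧∈ with A ∈? L | B ∈? L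
    ... | yes A∈ | _      = inj₁ (inj₁ A∈)
    ... | no  _  | yes B∈ = inj₁ (inj₂ B∈)
    ... | no  A∉ | no  B∉ = inj₂ (expand₂ _ _ (add-formula p L ts refl (proj₁ (∧-closed A∧B∈S)) A∉)
                                              (add-formula p L ts refl (proj₂ (∧-closed A∧B∈S)) B∉)
                                              (RuleSteps.∧-step p L ts A B ∧∈))
      where A∧B∈S = in-S p L ts refl ∧∈
    check-formula p L ts refl (□ A) □∈ with Occurs? A (labels (plug p (node L ts)))
    ... | yes occ = inj₁ occ
    ... | no  A∉  = inj₂ (expand₁ _ (new-child p L ts A w (□-closed (in-S p L ts refl □∈)) A∉)
                                    (RuleSteps.□-step p L ts A □∈))
    check-formula p L ts refl (■ A) _ = inj₁ tt
    check-formula p L ts refl (◆ A) _ = inj₁ tt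
    check-formula p L ts refl (◇ A) ◇∈ with A ∈? L
    ... | no  A∉ = inj₂ (expand₁ _ (add-formula p L ts refl (◇-closed (in-S p L ts refl ◇∈)) A∉)
                                   (RuleSteps.Tb-step p L ts A ◇∈))
    ... | yes A∈ with all-or-split ts (check-4c p L ts A ◇∈ refl)
    ...   | inj₁ ◇∈ts = inj₁ (A∈ , ◇∈ts)
    ...   | inj₂ e    = inj₂ e

    check-node : ∀ p L ts → plug p (node L ts) ≡ t → SaturatedNode (labels t) L ts ⊎ Expansion t
    check-node p L ts eq with all-or L (check-formula p L ts eq)
    ... | inj₂ e = inj₂ e
    ... | inj₁ formulas-ok with all-or-split ts (check-5b p L ts eq)
    ...   | inj₂ e           = inj₂ e
    ...   | inj₁ children-ok = inj₁ (formulas-ok , children-ok)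

    mutual
      check-subtree : ∀ p L ts → plug p (node L ts) ≡ t → Saturated (labels t) (node L ts) ⊎ Expansion t
      check-subtree p L ts eq with check-node p L ts eq
      ... | inj₂ e = inj₂ e
      ... | inj₁ node-ok with check-children p L [] ts eq
      ...   | inj₂ e           = inj₂ e
      ...   | inj₁ children-ok = inj₁ (node-ok , children-ok)

      check-children : ∀ p L ls rs → plug p (node L (ls ++ rs)) ≡ t → Saturated* (labels t) rs ⊎ Expansion t
      check-children p L ls []                  eq = inj₁ tt
      check-children p L ls (node Lc tsc ∷ rs) eq
        with check-subtree (p ++ frame L ls rs ∷ []) Lc tsc (trans (plug-∷ʳ p L ls rs (node Lc tsc)) eq)
      ... | inj₂ e = inj₂ e
      ... | inj₁ child-ok
        with check-children p L (ls ++ node Lc tsc ∷ []) rs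
               (trans (cong (λ us → plug p (node L us)) (++-assoc ls (node Lc tsc ∷ []) rs)) eq)
      ...   | inj₂ e        = inj₂ e
      ...   | inj₁ others-ok = inj₁ (child-ok , others-ok)

  SaturatedExtension : Tree → Set
  SaturatedExtension t = ∃ λ s → Saturated (labels s) s × (∀ {x} → Occurs x (labels t) → Occurs x (labels s))

  extend : ∀ {t t′} → (∀ {x} → Occurs x (labels t) → Occurs x (labels t′)) →
           SaturatedExtension t′ → SaturatedExtension t
  extend keeps′ (s , sat , keeps″) = s , sat , keeps″ ∘ keeps′

  search : ∀ t → Within (labels t) → Acc _<ₗₑₓ_ (measure (labels t)) → DKS5 ⌊ t ⌋ ⊎ SaturatedExtension t
  search (node L ts) w (acc rec) with Check.check-subtree (node L ts) w [] L ts refl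
  ... | inj₁ sat                  = inj₂ (node L ts , sat , λ o → o)
  ... | inj₂ (closed d)           = inj₁ d
  ... | inj₂ (expand₁ t′ prog step) with search t′ (within prog) (rec (decreases prog))
  ...   | inj₁ d = inj₁ (step d)
  ...   | inj₂ m = inj₂ (extend {node L ts} (keeps prog) m)
  search (node L ts) w (acc rec) | inj₂ (expand₂ t₁ t₂ prog₁ prog₂ step)
    with search t₁ (within prog₁) (rec (decreases prog₁)) | search t₂ (within prog₂) (rec (decreases prog₂))
  ... | inj₁ d₁ | inj₁ d₂ = inj₁ (step d₁ d₂)
  ... | inj₂ m  | _       = inj₂ (extend {node L ts} (keeps prog₁) m)
  ... | inj₁ _  | inj₂ m  = inj₂ (extend {node L ts} (keeps prog₂) m)

-- Completeness

subformulas : Fm → List Fm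
subformulas (pos n) = pos n ∷ []
subformulas (neg n) = neg n ∷ []
subformulas (A ∨ B) = (A ∨ B) ∷ subformulas A ++ subformulas B
subformulas (A ∧ B) = (A ∧ B) ∷ subformulas A ++ subformulas B
subformulas (□ A)   = □ A ∷ subformulas A
subformulas (■ A)   = ■ A ∷ subformulas A
subformulas (◇ A)   = ◇ A ∷ subformulas A
subformulas (◆ A)   = ◆ A ∷ subformulas A

∈-subformulas : ∀ A → A ∈ subformulas A
∈-subformulas (pos n) = here refl
∈-subformulas (neg n) = here refl
∈-subformulas (A ∨ B) = here refl
∈-subformulas (A ∧ B) = here refl
∈-subformulas (□ A)   = here refl
∈-subformulas (■ A)   = here refl
∈-subformulas (◇ A)   = here refl
∈-subformulas (◆ A)   = here refl

subformulas-trans : ∀ A {B C} → B ∈ subformulas A → C ∈ subformulas B → C ∈ subformulas A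
subformulas-trans (pos n) (here refl) C∈ = C∈
subformulas-trans (neg n) (here refl) C∈ = C∈
subformulas-trans (A ∨ B) (here refl) C∈ = C∈
subformulas-trans (A ∨ B) (there B∈) C∈ with ∈-++⁻ (subformulas A) B∈
... | inj₁ B∈A = there (∈-++⁺ˡ (subformulas-trans A B∈A C∈))
... | inj₂ B∈B = there (∈-++⁺ʳ (subformulas A) (subformulas-trans B B∈B C∈))
subformulas-trans (A ∧ B) (here refl) C∈ = C∈
subformulas-trans (A ∧ B) (there B∈) C∈ with ∈-++⁻ (subformulas A) B∈
... | inj₁ B∈A = there (∈-++⁺ˡ (subformulas-trans A B∈A C∈))
... | inj₂ B∈B = there (∈-++⁺ʳ (subformulas A) (subformulas-trans B B∈B C∈))
subformulas-trans (□ A) (here refl) C∈ = C∈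
subformulas-trans (□ A) (there B∈) C∈ = there (subformulas-trans A B∈ C∈)
subformulas-trans (■ A) (here refl) C∈ = C∈
subformulas-trans (■ A) (there B∈) C∈ = there (subformulas-trans A B∈ C∈)
subformulas-trans (◇ A) (here refl) C∈ = C∈
subformulas-trans (◇ A) (there B∈) C∈ = there (subformulas-trans A B∈ C∈)
subformulas-trans (◆ A) (here refl) C∈ = C∈
subformulas-trans (◆ A) (there B∈) C∈ = there (subformulas-trans A B∈ C∈)

subformulas-closed : ∀ A → SubformulaClosed (subformulas A)
subformulas-closed A = record
  { ∨-closed = λ {B} {C} ∈A → down ∈A (there (∈-++⁺ˡ (∈-subformulas B)))
                             , down ∈A (there (∈-++⁺ʳ (subformulas B) (∈-subformulas C)))
  ; ∧-closed = λ {B} {C} ∈A → down ∈A (there (∈-++⁺ˡ (∈-subformulas B)))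
                             , down ∈A (there (∈-++⁺ʳ (subformulas B) (∈-subformulas C)))
  ; □-closed = λ {B} ∈A → down ∈A (there (∈-subformulas B))
  ; ◇-closed = λ {B} ∈A → down ∈A (there (∈-subformulas B))
  }
  where down = subformulas-trans A

module Countermodel (s : Tree) (sat : Saturated (labels s) s) where

  -- An atom holds at L iff its negation is in L: labels never contain both literals.
  falsifying-valuation : List Fm → ℕ → Bool
  falsifying-valuation L n = does (neg n ∈? L)

  open UniversalModel (labels s) falsifying-valuation public

  mutual
    falsified : ∀ x {L} → L ∈ labels s → x ∈ L → ¬ T (⟦ x ⟧ᶠ L)
    falsified x L∈ x∈ with _ , (sat-L , _) ← saturated-node s sat L∈ = falsified-at x L∈ x∈ (lookup sat-L x∈)

    falsified-at : ∀ x {L ts} → L ∈ labels s → x ∈ L → Saturated-at (labels s) L ts x → ¬ T (⟦ x ⟧ᶠ L)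
    falsified-at (pos n) {L} _ _ neg∉ with neg n ∈? L
    ... | yes neg∈ = ⊥-elim (neg∉ neg∈)
    ... | no  _    = λ ()
    falsified-at (neg n) {L} _ neg∈ _ with neg n ∈? L
    ... | yes _    = λ ()
    ... | no  neg∉ = ⊥-elim (neg∉ neg∈)
    falsified-at (A ∨ B) L∈ _ (A∈ , B∈) = [ falsified A L∈ A∈ , falsified B L∈ B∈ ] ∘ Equivalence.to T-∨
    falsified-at (A ∧ B) L∈ _ (inj₁ A∈) = falsified A L∈ A∈ ∘ proj₁ ∘ Equivalence.to T-∧
    falsified-at (A ∧ B) L∈ _ (inj₂ B∈) = falsified B L∈ B∈ ∘ proj₂ ∘ Equivalence.to T-∧
    falsified-at (□ A) _ _ occ with L′ , L′∈ , A∈ ← find occ =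
      falsified A L′∈ A∈ ∘ (λ □A → lookup (all⁺ ⟦ A ⟧ᶠ (labels s) □A) L′∈)
    falsified-at (■ A) _ _ _ = λ ()
    falsified-at (◇ A) L∈ ◇∈ _ ◇A with L′ , L′∈ , A-true ← find (Anyₚ.any⁻ ⟦ A ⟧ᶠ (labels s) ◇A) =
      falsified A L′∈ (◇-everywhere s sat L∈ ◇∈ L′∈) A-true
    falsified-at (◆ A) _ _ _ = λ ()

completeness : ∀ A (m : Modal A) → S5 (tr A m) → DKS5 (fm A ∷ [])
completeness A m ⊢A with search (node (A ∷ []) []) start (<ₗₑₓ-wellFounded _)
  where
  open Search (subformulas A) (subformulas-closed A) using (Within; search)
  start : Within (labels (node (A ∷ []) []))
  start (here refl) (here refl) = ∈-subformulas A
... | inj₁ d = d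
... | inj₂ (s , sat , keeps) with L , L∈ , A∈ ← find (keeps (here (here refl))) =
  ⊥-elim (falsified A L∈ A∈ (subst T (tr-agrees A m L) (S5-sound ⊢A L∈)))
  where open Countermodel s sat

theorem5p11 : (A : Fm) → (m : Modal A) → DKS5 (fm A ∷ []) ⇔ S5 (tr A m)
theorem5p11 A m = mk⇔ (soundness A m) (completeness A m)
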